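{- Let $m\geq 4$ be an integer, and let $\Delta:[1,3m-4]\to[1,3]$ be a $3$-coloring. If $|\Delta^{ -1}(c)|\geq 3m-\left\lceil\frac{m}{2}\right\rceil-2$ for some $c\in[1,3]$, then $\Delta$ is not an $L(3)$-coloring (with respect to $m$).
   Context: For integers $a,b$, $[a,b]$ denotes the set of integers $i$ with $a\le i\le b$. An $m$-set $Z=(z_1,\ldots,z_m)$ is a set of $m$ positive integers listed increasingly, $z_1<\cdots<z_m$. For $m$-sets $X,Y$, write $X\prec Y$ if $x_m<y_1$. A set $T$ is monochromatic under a coloring $\Delta$ if $\Delta$ is constant on $T$. Given $m$ and $r$, an $r$-coloring $\Delta:S\to[1,r]$ of a nonempty set $S$ of integers is an $L(r)$-coloring if there do not exist monochromatic $m$-sets $X,Y\subset S$ with $X\prec Y$ and $2(x_m-x_1)\leq y_m-x_1$. -}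

module Defs where

open import Data.Nat using (ℕ; zero; suc; _+_; _*_; _∸_; _≤_; _<_)
open import Data.Fin using (Fin; zero; suc; fromℕ)
import Data.Fin as F
open import Data.Fin.Properties using () renaming (_≟_ to _≟ᶠ_)
open import Data.List using (List; length; filter)
open import Data.List using (upTo; map)
open import Data.Product using (Σ; _×_; _,_)
open import Relation.Binary.PropositionalEquality using (_≡_)
open import Relation.Nullary using (¬_)

-- An m-set: a strictly increasing sequence z_1 < ... < z_m of positive integers,
-- encoded as z : Fin m → ℕ (index i ↦ z_{i+1}).
StrictlyIncreasing : ∀ {m} → (Fin m → ℕ) → Set
StrictlyIncreasing {m} z = ∀ (i j : Fin m) → i F.< j → z i < z j

InRange : ∀ {m} → ℕ → ℕ → (Fin m → ℕ) → Set
InRange {m} a b z = ∀ (i : Fin m) → a ≤ z i × z i ≤ b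

MSetIn : (m N : ℕ) → (Fin m → ℕ) → Set
MSetIn m N z = StrictlyIncreasing z × InRange 1 N z

Monochromatic : ∀ {m r} → (ℕ → Fin r) → (Fin m → ℕ) → Set
Monochromatic {m} Δ z = ∀ (i j : Fin m) → Δ (z i) ≡ Δ (z j)

-- The forbidden configuration for m-sets X = (x_1..x_m), Y = (y_1..y_m), m = suc k:
-- X ≺ Y (x_m < y_1) and 2(x_m − x_1) ≤ y_m − x_1.
Forbidden : (k : ℕ) → (x y : Fin (suc k) → ℕ) → Set
Forbidden k x y =
  (x (fromℕ k) < y zero) ×
  (2 * (x (fromℕ k) ∸ x zero) ≤ y (fromℕ k) ∸ x zero)

-- Δ : ℕ → Fin r is regarded as an r-coloring of S = [1,N] (values outside [1,N]
-- are irrelevant).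
IsLColoring : (k r N : ℕ) → (ℕ → Fin r) → Set
IsLColoring k r N Δ =
  ¬ (Σ (Fin (suc k) → ℕ) λ x → Σ (Fin (suc k) → ℕ) λ y →
       MSetIn (suc k) N x × MSetIn (suc k) N y ×
       Monochromatic Δ x × Monochromatic Δ y × Forbidden k x y)

colorClassSize : ∀ {r} → ℕ → (ℕ → Fin r) → Fin r → ℕ
colorClassSize N Δ c = length (filter (λ i → Δ i ≟ᶠ c) (map suc (upTo N)))

module Submission where

-- Let v₀ < v₁ < ⋯ < v_{s-1} be the points of a colour class of size s ≥ 2m in [1,N],
-- and take X = (v₀,…,v_{m-1}) and Y = (v_{s-m},…,v_{s-1}).  Consecutive points differ
-- by at least 1, so y_m − x_m ≥ s − m, while x_m − x₁ ≤ (y_m − (s − m)) − 1 ≤ N − 1 − (s − m).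
-- Hence x_m − x₁ ≤ y_m − x_m as soon as N ≤ 2(s − m) + 1, which for N = 3m − 4 and
-- s ≥ 3m − ⌈m/2⌉ − 2 follows from 2⌈m/2⌉ ≤ m + 1.

open import Defs
open import Data.Nat using (ℕ; suc; _+_; _*_; _∸_; _≤_; ⌈_/2⌉)
open import Data.Fin using (Fin)
open import Data.Product using (Σ)
open import Relation.Nullary using (¬_)

open import Data.Nat using (zero; _<_; z≤n; s≤s)
open import Data.Nat.Properties
open import Data.Nat.Tactic.RingSolver using (solve; solve-∀)
open import Data.Fin using (zero; toℕ; fromℕ)
open import Data.Fin.Properties using (toℕ<n) renaming (_≟_ to _≟ᶠ_)
open import Data.List using (List; []; _∷_; length; filter; upTo; map)
open import Data.List.Relation.Unary.All as All using (All)
import Data.List.Relation.Unary.All.Properties as Allₚ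
open import Data.List.Relation.Unary.Linked as Linked using (Linked)
import Data.List.Relation.Unary.Linked.Properties as Linkedₚ
open import Data.Product using (_,_; _×_; proj₁; proj₂)
open import Function using (id)
open import Relation.Binary.PropositionalEquality using (_≡_; cong; sym; trans)

⌈n/2⌉+⌈n/2⌉≤1+n : ∀ n → ⌈ n /2⌉ + ⌈ n /2⌉ ≤ suc n
⌈n/2⌉+⌈n/2⌉≤1+n n = ≤-trans (+-monoʳ-≤ ⌈ n /2⌉ (⌊n/2⌋≤⌈n/2⌉ (suc n)))
                             (≤-reflexive (⌊n/2⌋+⌈n/2⌉≡n (suc n)))

⌈n/2⌉+2≤n : ∀ n → 4 ≤ n → ⌈ n /2⌉ + 2 ≤ n
⌈n/2⌉+2≤n 1 (s≤s ())
⌈n/2⌉+2≤n 2 (s≤s (s≤s ()))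
⌈n/2⌉+2≤n 3 (s≤s (s≤s (s≤s ())))
⌈n/2⌉+2≤n (suc (suc (suc (suc n)))) _ =
  s≤s (s≤s (≤-trans (≤-reflexive (+-comm ⌈ n /2⌉ 2)) (s≤s (s≤s (⌈n/2⌉≤n n)))))

2*[b∸a]≤e∸a : ∀ {a b e g N} → 1 ≤ a → a ≤ b → b + g ≤ e → e ≤ N → N ≤ 2 * g + 1 →
              2 * (b ∸ a) ≤ e ∸ a
2*[b∸a]≤e∸a {a} {b} {e} {g} {N} 1≤a a≤b b+g≤e e≤N N≤2g+1 =
  m+n≤o⇒m≤o∸n (2 * (b ∸ a)) (begin
    2 * (b ∸ a) + a     ≡⟨ regroup (b ∸ a) a ⟩
    b ∸ a + (b ∸ a + a) ≡⟨ cong (b ∸ a +_) (m∸n+n≡m a≤b) ⟩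
    b ∸ a + b           ≤⟨ +-monoˡ-≤ b b∸a≤g ⟩
    g + b               ≡⟨ +-comm g b ⟩
    b + g               ≤⟨ b+g≤e ⟩
    e                   ∎)
  where
  open ≤-Reasoning
  regroup : ∀ d a → 2 * d + a ≡ d + (d + a)
  regroup = solve-∀
  b≤1+g : b ≤ suc g
  b≤1+g = +-cancelʳ-≤ g b (suc g) (begin
    b + g       ≤⟨ ≤-trans b+g≤e e≤N ⟩
    N           ≤⟨ N≤2g+1 ⟩
    2 * g + 1   ≡⟨ solve (g ∷ []) ⟩
    suc g + g   ∎)
  b∸a≤g : b ∸ a ≤ g
  b∸a≤g = ≤-trans (∸-monoʳ-≤ b 1≤a) (∸-monoˡ-≤ 1 b≤1+g)

3m∸h∸2≤s⇒2m≤s×3m∸4≤2[s∸m]+1 : ∀ m h s → h + 2 ≤ m → h + h ≤ suc m → 3 * m ∸ h ∸ 2 ≤ s →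
                              m + m ≤ s × 3 * m ∸ 4 ≤ 2 * (s ∸ m) + 1
3m∸h∸2≤s⇒2m≤s×3m∸4≤2[s∸m]+1 m h s h+2≤m h+h≤1+m 3m∸h∸2≤s =
  2m≤s , 3m∸4≤2g+1 (s ∸ m) (m∸n+n≡m (m+n≤o⇒n≤o m 2m≤s))
  where
  open ≤-Reasoning
  3m≤h+2+s : 3 * m ≤ h + 2 + s
  3m≤h+2+s = begin
    3 * m                     ≤⟨ m≤n+m∸n (3 * m) (h + 2) ⟩
    h + 2 + (3 * m ∸ (h + 2)) ≡⟨ cong (h + 2 +_) (∸-+-assoc (3 * m) h 2) ⟨
    h + 2 + (3 * m ∸ h ∸ 2)   ≤⟨ +-monoʳ-≤ (h + 2) 3m∸h∸2≤s ⟩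
    h + 2 + s                 ∎
  2m≤s : m + m ≤ s
  2m≤s = +-cancelˡ-≤ (h + 2) (m + m) s (begin
    h + 2 + (m + m) ≤⟨ +-monoˡ-≤ (m + m) h+2≤m ⟩
    m + (m + m)     ≡⟨ solve (m ∷ []) ⟩
    3 * m           ≤⟨ 3m≤h+2+s ⟩
    h + 2 + s       ∎)
  3m∸4≤2g+1 : ∀ g → g + m ≡ s → 3 * m ∸ 4 ≤ 2 * g + 1
  3m∸4≤2g+1 g g+m≡s = m≤n+o⇒m∸n≤o (3 * m) 4 (+-cancelˡ-≤ m (3 * m) (4 + (2 * g + 1)) (begin
    m + 3 * m             ≡⟨ solve (m ∷ []) ⟩
    2 * (m + m)           ≤⟨ *-monoʳ-≤ 2 2m≤h+2+g ⟩
    2 * (h + 2 + g)       ≡⟨ solve (h ∷ g ∷ []) ⟩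
    h + h + (2 * g + 4)   ≤⟨ +-monoˡ-≤ (2 * g + 4) h+h≤1+m ⟩
    suc m + (2 * g + 4)   ≡⟨ solve (m ∷ g ∷ []) ⟩
    m + (4 + (2 * g + 1)) ∎))
    where
    2m≤h+2+g : m + m ≤ h + 2 + g
    2m≤h+2+g = +-cancelʳ-≤ m (m + m) (h + 2 + g) (begin
      m + m + m       ≡⟨ solve (m ∷ []) ⟩
      3 * m           ≤⟨ 3m≤h+2+s ⟩
      h + 2 + s       ≡⟨ cong (h + 2 +_) g+m≡s ⟨
      h + 2 + (g + m) ≡⟨ +-assoc (h + 2) g m ⟨
      h + 2 + g + m   ∎)

-- Out-of-range indices give the junk value 0.
nth : List ℕ → ℕ → ℕ
nth []       _       = 0
nth (x ∷ xs) zero    = x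
nth (x ∷ xs) (suc i) = nth xs i

All-nth : ∀ {P : ℕ → Set} {xs} → All P xs → ∀ {i} → i < length xs → P (nth xs i)
All-nth (px All.∷ pxs) {zero}  _         = px
All-nth (px All.∷ pxs) {suc i} (s≤s i<n) = All-nth pxs i<n

module _ {xs : List ℕ} (sorted : Linked _<_ xs) where

  nth-<-suc : ∀ {i} → suc i < length xs → nth xs i < nth xs (suc i)
  nth-<-suc = go sorted
    where
    go : ∀ {ys} → Linked _<_ ys → ∀ {i} → suc i < length ys → nth ys i < nth ys (suc i)
    go Linked.[-]      {zero}  (s≤s ())
    go (y<z Linked.∷ _) {zero}  _            = y<z
    go (_ Linked.∷ zs-sorted) {suc i} (s≤s i+1<n) = go zs-sorted i+1<n

  nth-+-≤ : ∀ i d → d + i < length xs → nth xs i + d ≤ nth xs (d + i)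
  nth-+-≤ i zero    _       = ≤-reflexive (+-identityʳ (nth xs i))
  nth-+-≤ i (suc d) 1+d+i<n = begin
    nth xs i + suc d     ≡⟨ +-suc (nth xs i) d ⟩
    suc (nth xs i + d)   ≤⟨ s≤s (nth-+-≤ i d (<-trans (n<1+n (d + i)) 1+d+i<n)) ⟩
    suc (nth xs (d + i)) ≤⟨ nth-<-suc 1+d+i<n ⟩
    nth xs (suc d + i)   ∎
    where open ≤-Reasoning

  nth-≤ : ∀ {i j} → i ≤ j → j < length xs → nth xs i ≤ nth xs j
  nth-≤ {i} {j} i≤j j<n = begin
    nth xs i             ≤⟨ m≤m+n (nth xs i) (j ∸ i) ⟩
    nth xs i + (j ∸ i)   ≤⟨ nth-+-≤ i (j ∸ i) (≤-<-trans (≤-reflexive j∸i+i≡j) j<n) ⟩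
    nth xs (j ∸ i + i)   ≡⟨ cong (nth xs) j∸i+i≡j ⟩
    nth xs j             ∎
    where
    open ≤-Reasoning
    j∸i+i≡j : j ∸ i + i ≡ j
    j∸i+i≡j = m∸n+n≡m i≤j

  nth-< : ∀ {i j} → i < j → j < length xs → nth xs i < nth xs j
  nth-< i<j j<n = <-≤-trans (nth-<-suc (≤-<-trans i<j j<n)) (nth-≤ i<j j<n)

window : ∀ {m} → List ℕ → ℕ → Fin m → ℕ
window xs i j = nth xs (i + toℕ j)

window-index< : ∀ {m} (xs : List ℕ) {i} → i + m ≤ length xs → (j : Fin m) → i + toℕ j < length xs
window-index< _ {i} i+m≤n j = <-≤-trans (+-monoʳ-< i (toℕ<n j)) i+m≤n

module _ {r} (N : ℕ) (Δ : ℕ → Fin r) (c : Fin r) where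

  colorClass : List ℕ
  colorClass = filter (λ v → Δ v ≟ᶠ c) (map suc (upTo N))

  colorClass-sorted : Linked _<_ colorClass
  colorClass-sorted = Linkedₚ.filter⁺ (λ v → Δ v ≟ᶠ c) <-trans
    (Linkedₚ.map⁺ (Linkedₚ.applyUpTo⁺₂ id N (λ v → s≤s (n<1+n v))))

  colorClass-⊆[1,N] : All (λ v → 1 ≤ v × v ≤ N) colorClass
  colorClass-⊆[1,N] = Allₚ.filter⁺ (λ v → Δ v ≟ᶠ c)
    (Allₚ.map⁺ (Allₚ.applyUpTo⁺₁ id N (λ v<N → s≤s z≤n , v<N)))

  colorClass-colored : All (λ v → Δ v ≡ c) colorClass
  colorClass-colored = Allₚ.all-filter (λ v → Δ v ≟ᶠ c) (map suc (upTo N))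

  module _ {m i} (i+m≤s : i + m ≤ colorClassSize N Δ c) where

    private
      index< : (j : Fin m) → i + toℕ j < length colorClass
      index< = window-index< colorClass i+m≤s

    colorClass-window-MSetIn : MSetIn m N (window colorClass i)
    colorClass-window-MSetIn =
      (λ j j′ j<j′ → nth-< colorClass-sorted (+-monoʳ-< i j<j′) (index< j′)) ,
      (λ j → All-nth colorClass-⊆[1,N] (index< j))

    colorClass-window-monochromatic : Monochromatic Δ (window colorClass i)
    colorClass-window-monochromatic j j′ =
      trans (All-nth colorClass-colored (index< j)) (sym (All-nth colorClass-colored (index< j′)))

largeColorClass⇒¬IsLColoring : ∀ {r} k N (Δ : ℕ → Fin r) c →
  suc k + suc k ≤ colorClassSize N Δ c →
  N ≤ 2 * (colorClassSize N Δ c ∸ suc k) + 1 →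
  ¬ IsLColoring k r N Δ
largeColorClass⇒¬IsLColoring k N Δ c 2m≤s N≤2g+1 isL =
  isL (x , y , x-MSet , y-MSet ,
       colorClass-window-monochromatic N Δ c x-fits ,
       colorClass-window-monochromatic N Δ c y-fits ,
       xₘ<y₁ , 2*[b∸a]≤e∸a 1≤x₁ x₁≤xₘ xₘ+g≤yₘ yₘ≤N N≤2g+1)
  where
  m : ℕ
  m = suc k
  L : List ℕ
  L = colorClass N Δ c
  g : ℕ
  g = length L ∸ m

  x-fits : 0 + m ≤ length L
  x-fits = m+n≤o⇒n≤o m 2m≤s
  y-fits : g + m ≤ length L
  y-fits = ≤-reflexive (m∸n+n≡m x-fits)

  x y : Fin m → ℕ
  x = window L 0
  y = window L g
  x-MSet : MSetIn m N x
  x-MSet = colorClass-window-MSetIn N Δ c x-fits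
  y-MSet : MSetIn m N y
  y-MSet = colorClass-window-MSetIn N Δ c y-fits

  xₘ<y₁ : x (fromℕ k) < y zero
  xₘ<y₁ = nth-< (colorClass-sorted N Δ c)
    (<-≤-trans (toℕ<n (fromℕ k)) (≤-trans (m+n≤o⇒m≤o∸n m 2m≤s) (m≤m+n g 0)))
    (window-index< L y-fits zero)
  1≤x₁ : 1 ≤ x zero
  1≤x₁ = proj₁ (proj₂ x-MSet zero)
  x₁≤xₘ : x zero ≤ x (fromℕ k)
  x₁≤xₘ = nth-≤ (colorClass-sorted N Δ c) z≤n (window-index< L x-fits (fromℕ k))
  xₘ+g≤yₘ : x (fromℕ k) + g ≤ y (fromℕ k)
  xₘ+g≤yₘ = nth-+-≤ (colorClass-sorted N Δ c) (toℕ (fromℕ k)) g (window-index< L y-fits (fromℕ k))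
  yₘ≤N : y (fromℕ k) ≤ N
  yₘ≤N = proj₂ (proj₂ y-MSet (fromℕ k))

lemma3p2 : (k : ℕ) → 4 ≤ suc k → (Δ : ℕ → Fin 3) →
    Σ (Fin 3) (λ c → 3 * suc k ∸ ⌈ suc k /2⌉ ∸ 2 ≤ colorClassSize (3 * suc k ∸ 4) Δ c) →
    ¬ IsLColoring k 3 (3 * suc k ∸ 4) Δ
lemma3p2 k 4≤m Δ (c , large) =
  let 2m≤s , 3m∸4≤2[s∸m]+1 = 3m∸h∸2≤s⇒2m≤s×3m∸4≤2[s∸m]+1 (suc k) ⌈ suc k /2⌉ _
                                (⌈n/2⌉+2≤n (suc k) 4≤m) (⌈n/2⌉+⌈n/2⌉≤1+n (suc k)) large
  in largeColorClass⇒¬IsLColoring k (3 * suc k ∸ 4) Δ c 2m≤s 3m∸4≤2[s∸m]+1
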